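{- Let $(G,k)$ be an instance of Vertex Cover, let $S\subseteq V(G)$, and let $G'$ be obtained from $G$ by adding a new vertex $v$ with neighborhood $S$. If $v$ is unconfined in $G'$, then $(G,k)$ and $(G',k+1)$ are equivalent.
   Context: Vertex Cover: given an undirected simple graph $G=(V,E)$ and an integer $k$, decide whether there is a set of at most $k$ vertices containing an endpoint of every edge. Two instances are equivalent if both are yes-instances or both are no-instances. For a vertex set $S$, $N(S)=\bigcup_{s\in S}N(s)\setminus S$ and $N[S]=N(S)\cup S$. A vertex $v$ of a graph $H$ is unconfined if the following procedure returns yes: (1) set $S=\{v\}$; (2) find $u\in N(S)$ with $|N(u)\cap S|=1$ such that $|N(u)\setminus N[S]|$ is minimum; (3) if no such $u$ exists, return no; (4) if $N(u)\setminus N[S]=\emptyset$, return yes; (5) if $N(u)\setminus N[S]=\{w\}$ for a single vertex $w$, add $w$ to $S$ and go to step (2); otherwise return no. -}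

module Defs where

open import Data.Nat using (ℕ; zero; suc; _≤_)
open import Data.Bool using (Bool; true; false; _∧_; _∨_; not)
open import Data.Fin using (Fin; zero; suc)
open import Data.Fin.Subset using (Subset; _∈_; _∉_; _∪_; _∩_; _─_; ∣_∣; ⁅_⁆; ⊥)
open import Data.Vec using (tabulate; lookup)
open import Data.Sum using (_⊎_)
open import Data.Product using (Σ; _×_)
open import Function using (_∘_)
open import Function.Bundles using (_⇔_)
open import Relation.Binary.PropositionalEquality using (_≡_; refl)

record Graph (n : ℕ) : Set where
  field
    adj    : Fin n → Fin n → Bool
    sym    : ∀ i j → adj i j ≡ adj j i
    irrefl : ∀ i → adj i i ≡ false
open Graph public

anyB : ∀ {n} → (Fin n → Bool) → Bool
anyB {zero}  f = false
anyB {suc n} f = f zero ∨ anyB (f ∘ suc)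

module _ {n : ℕ} (H : Graph n) where
  Nv : Fin n → Subset n
  Nv u = tabulate (adj H u)

  NS : Subset n → Subset n
  NS S = tabulate λ x → not (lookup S x) ∧ anyB (λ s → lookup S s ∧ adj H s x)

  NSc : Subset n → Subset n
  NSc S = NS S ∪ S

  IsVertexCover : Subset n → Set
  IsVertexCover C = ∀ i j → adj H i j ≡ true → i ∈ C ⊎ j ∈ C

  HasVC : ℕ → Set
  HasVC k = Σ (Subset n) λ C → IsVertexCover C × ∣ C ∣ ≤ k

  Candidate : Subset n → Fin n → Set
  Candidate S u = u ∈ NS S × ∣ Nv u ∩ S ∣ ≡ 1

  MinCandidate : Subset n → Fin n → Set
  MinCandidate S u = Candidate S u ×
    (∀ u′ → Candidate S u′ → ∣ Nv u ─ NSc S ∣ ≤ ∣ Nv u′ ─ NSc S ∣)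

  -- The confinement procedure, started at the current set S, returns yes.
  -- (A finite run; the choice among minimisers in step (2) is arbitrary.)
  data RunsToYes (S : Subset n) : Set where
    done : ∀ u → MinCandidate S u → Nv u ─ NSc S ≡ ⊥ → RunsToYes S
    grow : ∀ u w → MinCandidate S u → Nv u ─ NSc S ≡ ⁅ w ⁆ →
           RunsToYes (S ∪ ⁅ w ⁆) → RunsToYes S

  Unconfined : Fin n → Set
  Unconfined v = RunsToYes ⁅ v ⁆

-- G' : add a new vertex (index zero) whose neighbourhood is S;
-- old vertex i of G becomes suc i.
extAdj : ∀ {n} → Graph n → Subset n → Fin (suc n) → Fin (suc n) → Bool
extAdj G S zero    zero    = false
extAdj G S zero    (suc j) = lookup S j
extAdj G S (suc i) zero    = lookup S i
extAdj G S (suc i) (suc j) = adj G i j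

private
  extSym : ∀ {n} (G : Graph n) (S : Subset n) i j → extAdj G S i j ≡ extAdj G S j i
  extSym G S zero    zero    = refl
  extSym G S zero    (suc j) = refl
  extSym G S (suc i) zero    = refl
  extSym G S (suc i) (suc j) = sym G i j

  extIrr : ∀ {n} (G : Graph n) (S : Subset n) i → extAdj G S i i ≡ false
  extIrr G S zero    = refl
  extIrr G S (suc i) = irrefl G i

addVertex : ∀ {n} → Graph n → Subset n → Graph (suc n)
addVertex G S = record { adj = extAdj G S ; sym = extSym G S ; irrefl = extIrr G S }

-- Following a yes-run {v} = T₀ ⊂ T₁ ⊂ … ⊂ T_r of the procedure backwards,
-- every vertex cover C can be replaced by a cover of size at most |C| that
-- meets the current set T.  If C misses T, then N(T) ⊆ C, so the chosen
-- candidate u lies in C, and every neighbour of u other than its unique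
-- T-neighbour s lies in N(T) or in N(u) ∖ N[T] ⊆ C; thus C − u + s is a cover.
-- At a stopping step N(u) ∖ N[T] = ∅; at a growing step it is {w}, and the
-- cover obtained for T ∪ {w} either meets T or contains w.  Hence some minimum cover of G′
-- contains v, and deleting v from it leaves a cover of G.
module Submission where

open import Defs renaming (sym to adj-sym)
open import Data.Nat using (ℕ; suc; _≤_; _<_; s≤s)
open import Data.Nat.Properties using (≤-trans; ≤-reflexive; m≤n⇒m≤1+n; <⇒≱)
open import Data.Bool using (Bool; true; false)
open import Data.Bool.Properties using (∧-conicalˡ; ∧-conicalʳ)
open import Data.Fin using (Fin; zero; suc; _≟_)
open import Data.Fin.Subset
  using (Subset; inside; outside; _∈_; _⊆_; _∪_; _∩_; _─_; _-_; ∣_∣; ⁅_⁆; Nonempty; Empty)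
open import Data.Fin.Subset.Properties
  using ( _∈?_; nonempty?; ∉⊥; x∈⁅x⁆; x∈⁅y⁆⇒x≡y; drop-there; ∪-identityʳ
        ; x∈p∪q⁺; x∈p∪q⁻; x∈p∩q⁺; x∈p∩q⁻; x∈p∧x∉q⇒x∈p─q; x∈p∧x≢y⇒x∈p-y
        ; x∈p⇒∣p-x∣<∣p∣; p⊆q⇒∣p∣≤∣q∣; ∣⁅x⁆∣≡1)
open import Data.Vec using (_∷_; here; there; tabulate)
open import Data.Vec.Properties using (lookup∘tabulate; lookup⇒[]=; []=⇒lookup)
open import Data.Product using (Σ; ∃; _×_; _,_)
open import Data.Sum using (_⊎_; inj₁; inj₂)
import Data.Sum as Sum
open import Function.Bundles using (_⇔_; mk⇔)
open import Relation.Nullary using (yes; no; contradiction)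
open import Relation.Binary.PropositionalEquality
  using (_≡_; _≢_; refl; sym; trans; cong; subst)

∈-tabulate⁻ : ∀ {n} {f : Fin n → Bool} {x} → x ∈ tabulate f → f x ≡ true
∈-tabulate⁻ {f = f} {x} x∈ = trans (sym (lookup∘tabulate f x)) ([]=⇒lookup x∈)

∈-tabulate⁺ : ∀ {n} {f : Fin n → Bool} {x} → f x ≡ true → x ∈ tabulate f
∈-tabulate⁺ {f = f} {x} fx = lookup⇒[]= x _ (trans (lookup∘tabulate f x) fx)

anyB-witness : ∀ {n} (f : Fin n → Bool) → anyB f ≡ true → ∃ λ i → f i ≡ true
anyB-witness {suc n} f e with f zero in f0
... | true  = zero , f0
... | false with anyB-witness (λ i → f (suc i)) e
...   | i , fi = suc i , fi

∣p∪⁅x⁆∣≤1+∣p∣ : ∀ {n} (p : Subset n) x → ∣ p ∪ ⁅ x ⁆ ∣ ≤ suc ∣ p ∣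
∣p∪⁅x⁆∣≤1+∣p∣ (inside  ∷ p) zero    = s≤s (m≤n⇒m≤1+n (≤-reflexive (cong ∣_∣ (∪-identityʳ p))))
∣p∪⁅x⁆∣≤1+∣p∣ (outside ∷ p) zero    = s≤s (≤-reflexive (cong ∣_∣ (∪-identityʳ p)))
∣p∪⁅x⁆∣≤1+∣p∣ (inside  ∷ p) (suc x) = s≤s (∣p∪⁅x⁆∣≤1+∣p∣ p x)
∣p∪⁅x⁆∣≤1+∣p∣ (outside ∷ p) (suc x) = ∣p∪⁅x⁆∣≤1+∣p∣ p x

∣p-x∪⁅y⁆∣≤∣p∣ : ∀ {n} {p : Subset n} {x} y → x ∈ p → ∣ (p - x) ∪ ⁅ y ⁆ ∣ ≤ ∣ p ∣
∣p-x∪⁅y⁆∣≤∣p∣ {p = p} {x} y x∈p = ≤-trans (∣p∪⁅x⁆∣≤1+∣p∣ (p - x) y) (x∈p⇒∣p-x∣<∣p∣ x∈p)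

∣p∣≡1⇒x≡y : ∀ {n} {p : Subset n} {x y} → ∣ p ∣ ≡ 1 → x ∈ p → y ∈ p → x ≡ y
∣p∣≡1⇒x≡y {p = p} {x} {y} ∣p∣≡1 x∈p y∈p with x ≟ y
... | yes x≡y = x≡y
... | no  x≢y = contradiction lower (<⇒≱ upper)
  where
  ⁅y⁆⊆p-x : ⁅ y ⁆ ⊆ p - x
  ⁅y⁆⊆p-x z∈⁅y⁆ with x∈⁅y⁆⇒x≡y y z∈⁅y⁆
  ... | refl = x∈p∧x≢y⇒x∈p-y y∈p (λ y≡x → x≢y (sym y≡x))
  lower : 1 ≤ ∣ p - x ∣
  lower = subst (_≤ ∣ p - x ∣) (∣⁅x⁆∣≡1 y) (p⊆q⇒∣p∣≤∣q∣ ⁅y⁆⊆p-x)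
  upper : ∣ p - x ∣ < 1
  upper = subst (∣ p - x ∣ <_) ∣p∣≡1 (x∈p⇒∣p-x∣<∣p∣ x∈p)

⁅x⁆∩p-nonempty⇒x∈p : ∀ {n} {x : Fin n} {p} → Nonempty (⁅ x ⁆ ∩ p) → x ∈ p
⁅x⁆∩p-nonempty⇒x∈p {x = x} {p} (y , y∈) with x∈p∩q⁻ ⁅ x ⁆ p y∈
... | y∈⁅x⁆ , y∈p with x∈⁅y⁆⇒x≡y x y∈⁅x⁆
...   | refl = y∈p

module _ {n : ℕ} (H : Graph n) where

  HasVCMeeting : Subset n → ℕ → Set
  HasVCMeeting T k = Σ (Subset n) λ C → IsVertexCover H C × ∣ C ∣ ≤ k × Nonempty (T ∩ C)

  adjacent⇒≢ : ∀ {u j} → adj H u j ≡ true → u ≢ j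
  adjacent⇒≢ {u} e refl with trans (sym e) (irrefl H u)
  ... | ()

  NS⇒adjacent : ∀ {T x} → x ∈ NS H T → ∃ λ t → t ∈ T × adj H t x ≡ true
  NS⇒adjacent {T} x∈NT with anyB-witness _ (∧-conicalʳ _ _ (∈-tabulate⁻ x∈NT))
  ... | t , t∈T∧t~x = t , lookup⇒[]= t T (∧-conicalˡ _ _ t∈T∧t~x) , ∧-conicalʳ _ _ t∈T∧t~x

  NS⊆cover : ∀ {T C} → IsVertexCover H C → Empty (T ∩ C) → NS H T ⊆ C
  NS⊆cover vc T∩C≡∅ x∈NT with NS⇒adjacent x∈NT
  ... | t , t∈T , t~x with vc t _ t~x
  ...   | inj₁ t∈C = contradiction (t , x∈p∩q⁺ (t∈T , t∈C)) T∩C≡∅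
  ...   | inj₂ x∈C = x∈C

  cover-exchange : ∀ {C u s} → IsVertexCover H C →
                   (∀ {j} → adj H u j ≡ true → j ∈ C ⊎ j ≡ s) →
                   IsVertexCover H ((C - u) ∪ ⁅ s ⁆)
  cover-exchange {C} {u} {s} vc nbrs = cover
    where
    keep : ∀ {x} → x ∈ C → x ≢ u → x ∈ (C - u) ∪ ⁅ s ⁆
    keep x∈C x≢u = x∈p∪q⁺ (inj₁ (x∈p∧x≢y⇒x∈p-y x∈C x≢u))
    covers-nbr : ∀ {j} → adj H u j ≡ true → j ∈ (C - u) ∪ ⁅ s ⁆
    covers-nbr u~j with nbrs u~j
    ... | inj₁ j∈C = keep j∈C (λ j≡u → adjacent⇒≢ u~j (sym j≡u))
    ... | inj₂ refl = x∈p∪q⁺ (inj₂ (x∈⁅x⁆ s))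
    cover : IsVertexCover H ((C - u) ∪ ⁅ s ⁆)
    cover i j e with vc i j e | i ≟ u | j ≟ u
    ... | _        | yes refl | _        = inj₂ (covers-nbr e)
    ... | _        | no _     | yes refl = inj₁ (covers-nbr (trans (adj-sym H u i) e))
    ... | inj₁ i∈C | no i≢u   | no _     = inj₁ (keep i∈C i≢u)
    ... | inj₂ j∈C | no _     | no j≢u   = inj₂ (keep j∈C j≢u)

  candidate-neighbours : ∀ {T C u s} → ∣ Nv H u ∩ T ∣ ≡ 1 → s ∈ T → adj H s u ≡ true →
                         IsVertexCover H C → Empty (T ∩ C) → Nv H u ─ NSc H T ⊆ C →
                         ∀ {j} → adj H u j ≡ true → j ∈ C ⊎ j ≡ s
  candidate-neighbours {T} {u = u} {s} ∣N[u]∩T∣≡1 s∈T s~u vc T∩C≡∅ outer⊆C {j} u~j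
    with j ∈? NSc H T
  ... | no j∉N[T] = inj₁ (outer⊆C (x∈p∧x∉q⇒x∈p─q (∈-tabulate⁺ u~j) j∉N[T]))
  ... | yes j∈N[T] with x∈p∪q⁻ (NS H T) T j∈N[T]
  ...   | inj₁ j∈NT = inj₁ (NS⊆cover vc T∩C≡∅ j∈NT)
  ...   | inj₂ j∈T  = inj₂ (∣p∣≡1⇒x≡y ∣N[u]∩T∣≡1
                              (x∈p∩q⁺ (∈-tabulate⁺ u~j , j∈T))
                              (x∈p∩q⁺ (∈-tabulate⁺ (trans (adj-sym H u s) s~u) , s∈T)))

  meet-or-exchange : ∀ {T C u k} → Candidate H T u → IsVertexCover H C → ∣ C ∣ ≤ k →
             (Empty (T ∩ C) → Nv H u ─ NSc H T ⊆ C) → HasVCMeeting T k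
  meet-or-exchange {T} {C} {u} (u∈NT , ∣N[u]∩T∣≡1) vc ∣C∣≤k outer⊆C with nonempty? (T ∩ C)
  ... | yes T∩C≢∅ = C , vc , ∣C∣≤k , T∩C≢∅
  ... | no  T∩C≡∅ with NS⇒adjacent u∈NT
  ...   | s , s∈T , s~u =
    (C - u) ∪ ⁅ s ⁆ ,
    cover-exchange vc (candidate-neighbours ∣N[u]∩T∣≡1 s∈T s~u vc T∩C≡∅ (outer⊆C T∩C≡∅)) ,
    ≤-trans (∣p-x∪⁅y⁆∣≤∣p∣ s (NS⊆cover vc T∩C≡∅ u∈NT)) ∣C∣≤k ,
    s , x∈p∩q⁺ (s∈T , x∈p∪q⁺ (inj₂ (x∈⁅x⁆ s)))

  runsToYes⇒HasVCMeeting : ∀ {T k} → RunsToYes H T → HasVC H k → HasVCMeeting T k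
  runsToYes⇒HasVCMeeting (done u (cand , _) outer≡∅) (C , vc , ∣C∣≤k) =
    meet-or-exchange cand vc ∣C∣≤k λ _ x∈outer → contradiction (subst (_ ∈_) outer≡∅ x∈outer) ∉⊥
  runsToYes⇒HasVCMeeting {T} (grow u w (cand , _) outer≡⁅w⁆ run) hasVC
    with runsToYes⇒HasVCMeeting run hasVC
  ... | C , vc , ∣C∣≤k , (x , x∈T∪⁅w⁆∩C) = meet-or-exchange cand vc ∣C∣≤k outer⊆C
    where
    outer⊆C : Empty (T ∩ C) → Nv H u ─ NSc H T ⊆ C
    outer⊆C T∩C≡∅ y∈outer with x∈p∩q⁻ (T ∪ ⁅ w ⁆) C x∈T∪⁅w⁆∩C
    ... | x∈T∪⁅w⁆ , x∈C with x∈p∪q⁻ T ⁅ w ⁆ x∈T∪⁅w⁆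
    ...   | inj₁ x∈T = contradiction (x , x∈p∩q⁺ (x∈T , x∈C)) T∩C≡∅
    ...   | inj₂ x∈⁅w⁆
      with x∈⁅y⁆⇒x≡y w x∈⁅w⁆ | x∈⁅y⁆⇒x≡y w (subst (_ ∈_) outer≡⁅w⁆ y∈outer)
    ...     | refl | refl = x∈C

module _ {n : ℕ} (G : Graph n) (S : Subset n) where

  extend-cover : ∀ {C} → IsVertexCover G C → IsVertexCover (addVertex G S) (inside ∷ C)
  extend-cover vc zero    zero    ()
  extend-cover vc zero    (suc j) _ = inj₁ here
  extend-cover vc (suc i) zero    _ = inj₂ here
  extend-cover vc (suc i) (suc j) e = Sum.map there there (vc i j e)

  restrict-cover : ∀ {b C} → IsVertexCover (addVertex G S) (b ∷ C) → IsVertexCover G C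
  restrict-cover vc i j e = Sum.map drop-there drop-there (vc (suc i) (suc j) e)

lemma9 : ∀ {n} (G : Graph n) (k : ℕ) (S : Subset n) →
         Unconfined (addVertex G S) zero →
         HasVC G k ⇔ HasVC (addVertex G S) (suc k)
lemma9 G k S unconfined = mk⇔ extend shrink
  where
  extend : HasVC G k → HasVC (addVertex G S) (suc k)
  extend (C , vc , ∣C∣≤k) = inside ∷ C , extend-cover G S vc , s≤s ∣C∣≤k
  delete-new-vertex : ∀ {C} → zero ∈ C → IsVertexCover (addVertex G S) C → ∣ C ∣ ≤ suc k → HasVC G k
  delete-new-vertex {inside ∷ C} here vc (s≤s ∣C∣≤k) = C , restrict-cover G S vc , ∣C∣≤k
  shrink : HasVC (addVertex G S) (suc k) → HasVC G k
  shrink hasVC with runsToYes⇒HasVCMeeting (addVertex G S) unconfined hasVC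
  ... | C , vc , ∣C∣≤1+k , v∈C = delete-new-vertex (⁅x⁆∩p-nonempty⇒x∈p v∈C) vc ∣C∣≤1+k
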